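{- Let $\mathbb{F}_q$ be a finite field, $m$ a positive divisor of $q-1$, $n$ a positive integer, and $f(x)=x^nh\big(x^{\frac{q-1}{m}}\big)\in\mathbb{F}_q[x]$ a polynomial of index $m$ which is $m$-nice over $\mathbb{F}_q$. Write $\frac{q-1}{m}=\nu\omega$, where $\omega$ is the greatest divisor of $\frac{q-1}{m}$ relatively prime to $n$. Then for every $a\in\mathbb{F}_q^*$, the graph $R_a\big(\mathcal{G}(f/\mathbb{F}_q)\big)$ is $\gcd_n(\nu)$-regular.
   Context: $\mathcal{G}(f/\mathbb{F}_q)$ is the functional graph: vertex set $\mathbb{F}_q$, edges $a\to f(a)$. In a directed graph, $c$ is a predecessor of $b$ if $b$ is reachable from $c$ (a $k$-distant predecessor if at distance $k$); $R_b(\mathcal G)$ is the subgraph of $\mathcal G$ consisting of all predecessors of $b$, including $b$. For a non-increasing sequence of positive integers $V=(v_1,\dots,v_D)$, set $v_i=v_D$ for $i\ge D+1$; a directed graph is $V$-regular if for each positive integer $k$ the number of $k$-distant predecessors of any vertex is either $0$ or $v_1\cdots v_k$. For a positive integer $v$, $\gcd_n(v)=(v_1,\dots,v_s)$ with $v_i=\gcd(n^i,v)/\gcd(n^{i-1},v)$ and $s$ the least positive integer with $v_s=1$. $\mu_m$ is the set of $m$-th roots of unity in $\mathbb{F}_q$. A polynomial $f$ with $f(0)=0$ is written uniquely as $f(x)=x^nh(x^{\frac{q-1}{m}})$ with $h(0)\ne0$ and $m\mid q-1$ minimal ($m$ is the index). Put $\psi_f(x)=x^nh(x)^{\frac{q-1}{m}}$;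 $f$ is $m$-nice over $\mathbb{F}_q$ if $\psi_f$ restricted to $\mu_m\setminus\psi_f^{ -1}(0)$ is an injective map into $\mu_m$. -}

module Defs where

open import Level using (0ℓ)
open import Data.Nat as ℕ using (ℕ; zero; suc; _≤_; _<_; _∸_)
open import Data.Nat.DivMod using (_/_)
open import Data.Nat.GCD using (gcd)
open import Data.Fin using (Fin)
open import Data.List using (List; []; _∷_; replicate; _++_; length)
open import Data.List.Relation.Unary.Unique.Propositional using (Unique)
open import Data.List.Membership.Propositional using (_∈_)
open import Data.Product using (Σ; ∃; _×_; _,_)
open import Data.Sum using (_⊎_)
open import Data.Unit using (⊤)
open import Relation.Binary.PropositionalEquality using (_≡_; _≢_)
open import Relation.Nullary using (yes; no)
open import Algebra.Structures using (IsCommutativeRing)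
open import Function.Bundles using (_↔_)

record FiniteField : Set₁ where
  infixl 6 _+_
  infixl 7 _*_
  field
    Carrier    : Set
    _+_ _*_    : Carrier → Carrier → Carrier
    -_         : Carrier → Carrier
    0# 1#      : Carrier
    isCommutativeRing : IsCommutativeRing _≡_ _+_ _*_ -_ 0# 1#
    0≢1        : 0# ≢ 1#
    inverse    : ∀ x → x ≢ 0# → Σ Carrier (λ y → x * y ≡ 1#)
    size       : ℕ
    enumeration : Fin size ↔ Carrier

module _ (K : FiniteField) where
  open FiniteField K

  pow : Carrier → ℕ → Carrier
  pow x zero    = 1#
  pow x (suc k) = x * pow x k

  -- Polynomials over K: coefficient lists, lowest degree first.
  Poly : Set
  Poly = List Carrier

  coeff : Poly → ℕ → Carrier
  coeff []       _       = 0#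
  coeff (c ∷ cs) zero    = c
  coeff (c ∷ cs) (suc i) = coeff cs i

  _≈ₚ_ : Poly → Poly → Set
  p ≈ₚ r = ∀ i → coeff p i ≡ coeff r i

  eval : Poly → Carrier → Carrier
  eval []       x = 0#
  eval (c ∷ cs) x = c + x * eval cs x

  -- h(x^e) as a formal polynomial (for e ≥ 1)
  substPow : ℕ → Poly → Poly
  substPow e []       = []
  substPow e (c ∷ cs) = c ∷ (replicate (e ∸ 1) 0# ++ substPow e cs)

  shiftPoly : ℕ → Poly → Poly
  shiftPoly n p = replicate n 0# ++ p

  Rep : Poly → ℕ → ℕ → Poly → Set
  Rep f e n h = (coeff h 0 ≢ 0#) × (f ≈ₚ shiftPoly n (substPow e h))

  psi : ℕ → ℕ → Poly → Carrier → Carrier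
  psi e n h x = pow x n * pow (eval h x) e

  μ : ℕ → Carrier → Set
  μ m x = pow x m ≡ 1#

  Nice : ℕ → ℕ → ℕ → Poly → Set
  Nice m e n h =
    (∀ x → μ m x → psi e n h x ≢ 0# → μ m (psi e n h x)) ×
    (∀ x y → μ m x → μ m y → psi e n h x ≢ 0# → psi e n h y ≢ 0# →
       psi e n h x ≡ psi e n h y → x ≡ y)

-- Directed graphs (possibly a subgraph: Vertex selects the vertices)

record DiGraph : Set₁ where
  field
    Node   : Set
    Vertex : Node → Set
    Edge   : Node → Node → Set

module _ (G : DiGraph) where
  open DiGraph G

  data Walk : ℕ → Node → Node → Set where
    here : ∀ {b} → Vertex b → Walk zero b b
    step : ∀ {k c d b} → Vertex c → Edge c d → Walk k d b → Walk (suc k) c b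

  Predecessor : Node → Node → Set
  Predecessor c b = ∃ λ k → Walk k c b

  R : Node → DiGraph
  R b = record { Node = Node
               ; Vertex = λ c → Vertex c × Predecessor c b
               ; Edge = Edge }

  Count : (Node → Set) → ℕ → Set
  Count P N = Σ (List Node) λ xs →
    Unique xs × length xs ≡ N × (∀ c → (c ∈ xs → P c) × (P c → c ∈ xs))

-- extension of a finite sequence (v₁,…,v_D) by v_i = v_D for i > D
-- (1-based indexing)
extend : List ℕ → ℕ → ℕ
extend []           i             = 1
extend (v ∷ [])     i             = v
extend (v ∷ w ∷ vs) zero          = v
extend (v ∷ w ∷ vs) (suc zero)    = v
extend (v ∷ w ∷ vs) (suc (suc i)) = extend (w ∷ vs) (suc i)

prodUpTo : (ℕ → ℕ) → ℕ → ℕ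
prodUpTo v zero    = 1
prodUpTo v (suc k) = prodUpTo v k ℕ.* v (suc k)

Regular : DiGraph → List ℕ → Set
Regular G V = ∀ b → DiGraph.Vertex G b → ∀ k → 1 ≤ k →
  Count G (λ c → Walk G k c b) 0 ⊎ Count G (λ c → Walk G k c b) (prodUpTo (extend V) k)

-- gcd_n(v) = (v₁,…,v_s), v_i = gcd(n^i,v)/gcd(n^(i-1),v), s least with v_s = 1

private
  div : ℕ → ℕ → ℕ
  div a zero    = 0
  div a (suc b) = a / suc b

gcdRatio : ℕ → ℕ → ℕ → ℕ
gcdRatio n v i = div (gcd (n ℕ.^ i) v) (gcd (n ℕ.^ (i ∸ 1)) v)

-- iterate from index i with fuel; fuel (suc v) always suffices for v ≥ 1
gcdSeqFrom : ℕ → ℕ → ℕ → ℕ → List ℕ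
gcdSeqFrom n v zero       i = []
gcdSeqFrom n v (suc fuel) i with gcdRatio n v i ℕ.≟ 1
... | yes _ = 1 ∷ []
... | no  _ = gcdRatio n v i ∷ gcdSeqFrom n v fuel (suc i)

gcdN : ℕ → ℕ → List ℕ
gcdN n v = gcdSeqFrom n v (suc v) 1

FunctionalGraph : (K : FiniteField) → Poly K → DiGraph
FunctionalGraph K f = record
  { Node = FiniteField.Carrier K
  ; Vertex = λ _ → ⊤
  ; Edge = λ a b → eval K f a ≡ b }

module Submission where

-- Write F for the polynomial map of f and e = (q-1)/m. From f(x) = x^n h(x^e) one reads off F(ζx) = ζ^n F(x)
-- for ζ ∈ μ_e and F(x)^e = ψ_f(x^e), where x^e ∈ μ_m for x ≠ 0. Niceness thus makes two points with the same
-- nonzero image under F^k have the same e-th power, so the fibre of F^k over a nonzero b ∋ x₀ is the coset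
-- x₀·{ζ : ζ^e = 1 = ζ^(n^k)} = x₀·μ_g with g = gcd(e, n^k); it has exactly g elements since g ∣ q-1. Every
-- vertex of R_a is nonzero because F(0) = 0 ≠ a, and as ω is coprime to n,
-- g = gcd(νω, n^k) = gcd(n^k, ν) = v₁⋯v_k for (v_i) = gcd_n(ν), the ratios telescoping.

open import Defs
open import Level using (0ℓ)
open import Algebra.Bundles using (CommutativeRing)
import Algebra.Solver.Ring.NaturalCoefficients.Default as SemiringSolver
open import Data.Nat as ℕ using (ℕ; zero; suc; _∸_; _≤_; _<_; z≤n; s≤s; ≢-nonZero; >-nonZero)
import Data.Nat.Properties as ℕ
open import Data.Nat.DivMod using (m/n*n≡m)
open import Data.Nat.Divisibility using (_∣_; divides; ∣1⇒≡1; ∣-trans; ∣-antisym; ∣⇒≤; n∣m*n; m∣m*n; *-monoʳ-∣)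
open import Data.Nat.GCD
  using (gcd; gcd-GCD; module Bézout; gcd[m,n]∣m; gcd[m,n]∣n; gcd[m,n]≢0; gcd-greatest; gcd-zeroˡ; c*gcd[m,n]≡gcd[cm,cn])
open import Data.Nat.Coprimality using (Coprime; coprime-divisor)
open import Data.Fin.Properties as Fin using ()
open import Data.List using (List; []; _∷_; length; map; filter; foldr; replicate; tabulate)
open import Data.List.Properties using (length-map; length-tabulate; length-++; length-replicate)
open import Data.List.Relation.Unary.All as All using (All; []; _∷_)
open import Data.List.Relation.Unary.Any using (here; there; any?; satisfied)
open import Data.List.Relation.Unary.AllPairs using ([]; _∷_)
open import Data.List.Relation.Unary.Unique.Propositional using (Unique)
import Data.List.Relation.Unary.Unique.Propositional.Properties as Unique
open import Data.List.Membership.Propositional using (_∈_; lose)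
open import Data.List.Membership.Propositional.Properties
  using (∈-map⁺; ∈-map⁻; ∈-tabulate⁺; ∈-filter⁺; ∈-filter⁻; ∈-length)
open import Data.List.Membership.Propositional.Properties.WithK using (unique∧set⇒bag)
open import Data.List.Relation.Binary.BagAndSetEquality using (∼bag⇒↭)
open import Data.List.Relation.Binary.Permutation.Propositional using (_↭_; ↭⇒↭ₛ)
open import Data.List.Relation.Binary.Permutation.Propositional.Properties using (↭-length)
open import Data.List.Relation.Binary.Permutation.Setoid.Properties using (foldr-commMonoid)
open import Data.Product using (∃; _×_; _,_; proj₁; proj₂)
open import Data.Sum using (_⊎_; inj₁; inj₂; map₂)
open import Data.Empty using (⊥-elim)
open import Data.Unit using (tt)
open import Function.Base using (_∘_)
open import Function.Bundles using (Inverse; Injection; Equivalence; _⇔_; mk⇔)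
open import Function.Properties.Inverse using (↔-sym; ↔⇒↣)
open import Relation.Nullary using (Dec; yes; no; ¬_; ¬?)
open import Relation.Nullary.Decidable using (via-injection; map′; decidable-stable)
open import Relation.Unary using (Decidable)
open import Relation.Unary.Properties using (∁?)
open import Relation.Binary.Definitions using (DecidableEquality)
open import Relation.Binary.PropositionalEquality

module _ {A : Set} {P : A → Set} (P? : Decidable P) where

  length-filter+length-filter-∁ : ∀ xs → length (filter P? xs) ℕ.+ length (filter (∁? P?) xs) ≡ length xs
  length-filter+length-filter-∁ []       = refl
  length-filter+length-filter-∁ (x ∷ xs) with P? x
  ... | yes _ = cong suc (length-filter+length-filter-∁ xs)
  ... | no  _ = trans (ℕ.+-suc _ _) (cong suc (length-filter+length-filter-∁ xs))

iterate : {A : Set} → (A → A) → ℕ → A → A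
iterate g zero    x = x
iterate g (suc k) x = iterate g k (g x)

-- Walks and counting in directed graphs

module _ {G : DiGraph} where
  open DiGraph G

  walk-++ : ∀ {k j c d b} → Walk G k c d → Walk G j d b → Walk G (k ℕ.+ j) c b
  walk-++ (here _)         w′ = w′
  walk-++ (step c∈G c→d w) w′ = step c∈G c→d (walk-++ w w′)

  restrict : ∀ {a b k c} → Predecessor G b a → Walk G k c b → Walk (R G a) k c b
  restrict b≺a           (here b∈G)          = here (b∈G , b≺a)
  restrict b≺a@(_ , b⇝a) w@(step c∈G c→d w′) = step (c∈G , (_ , walk-++ w b⇝a)) c→d (restrict b≺a w′)

  unrestrict : ∀ {a b k c} → Walk (R G a) k c b → Walk G k c b
  unrestrict (here (b∈G , _))       = here b∈G
  unrestrict (step (c∈G , _) c→d w) = step c∈G c→d (unrestrict w)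

module _ (G : DiGraph) where
  open DiGraph G

  Count-cong : ∀ {P Q : Node → Set} {N} → (∀ c → P c ⇔ Q c) → Count G P N → Count G Q N
  Count-cong P⇔Q (xs , xs-unique , len , xs≐P) =
    xs , xs-unique , len ,
    λ c → Equivalence.to (P⇔Q c) ∘ proj₁ (xs≐P c) , proj₂ (xs≐P c) ∘ Equivalence.from (P⇔Q c)

  Count-none : ∀ {P : Node → Set} → (∀ c → ¬ P c) → Count G P 0
  Count-none ¬P = [] , [] , refl , λ c → (λ ()) , λ pc → ⊥-elim (¬P c pc)

module FiniteFieldTheory (K : FiniteField) where

  open FiniteField K

  commutativeRing : CommutativeRing 0ℓ 0ℓ
  commutativeRing = record { isCommutativeRing = isCommutativeRing }

  open CommutativeRing commutativeRing
    using (+-assoc; +-comm; +-identityˡ; +-identityʳ; -‿inverseˡ;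
           *-assoc; *-comm; *-identityˡ; *-identityʳ; zeroˡ; zeroʳ; _-_;
           ring; semiring; commutativeSemiring; *-isCommutativeMonoid; *-commutativeSemigroup)
  open import Algebra.Properties.Ring ring using (+-cancelˡ; -‿injective; -0#≈0#; x∙y⁻¹≈ε⇒x≈y; xyx⁻¹≈y)
  import Algebra.Properties.Semiring.Exp semiring as Exp
  open import Algebra.Properties.CommutativeSemigroup *-commutativeSemigroup using () renaming (interchange to *-interchange)
  open import Algebra.Properties.CommutativeSemiring.Exp commutativeSemiring using (^-distrib-*)
  open SemiringSolver commutativeSemiring using (solve; _:+_; _:*_; _:=_; con)

  -- Arithmetic in a finite field

  _≟_ : DecidableEquality Carrier
  _≟_ = via-injection (↔⇒↣ (↔-sym enumeration)) Fin._≟_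

  1#≢0# : 1# ≢ 0#
  1#≢0# 1≡0 = 0≢1 (sym 1≡0)

  -1#≢0# : - 1# ≢ 0#
  -1#≢0# -1≡0 = 1#≢0# (-‿injective (trans -1≡0 (sym -0#≈0#)))

  *-surjective : ∀ {x} → x ≢ 0# → ∀ y → ∃ λ z → x * z ≡ y
  *-surjective {x} x≢0 y with inverse x x≢0
  ... | x⁻¹ , x*x⁻¹≡1 = x⁻¹ * y , (begin
    x * (x⁻¹ * y) ≡⟨ *-assoc x x⁻¹ y ⟨
    (x * x⁻¹) * y ≡⟨ cong (_* y) x*x⁻¹≡1 ⟩
    1# * y        ≡⟨ *-identityˡ y ⟩
    y             ∎)
    where open ≡-Reasoning

  *-cancelˡ-≢0 : ∀ {x y z} → x ≢ 0# → x * y ≡ x * z → y ≡ z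
  *-cancelˡ-≢0 {x} {y} {z} x≢0 xy≡xz with inverse x x≢0
  ... | x⁻¹ , x*x⁻¹≡1 = begin
    y               ≡⟨ *-identityˡ y ⟨
    1# * y          ≡⟨ cong (_* y) (trans (sym x*x⁻¹≡1) (*-comm x x⁻¹)) ⟩
    (x⁻¹ * x) * y   ≡⟨ *-assoc x⁻¹ x y ⟩
    x⁻¹ * (x * y)   ≡⟨ cong (x⁻¹ *_) xy≡xz ⟩
    x⁻¹ * (x * z)   ≡⟨ *-assoc x⁻¹ x z ⟨
    (x⁻¹ * x) * z   ≡⟨ cong (_* z) (trans (*-comm x⁻¹ x) x*x⁻¹≡1) ⟩
    1# * z          ≡⟨ *-identityˡ z ⟩
    z               ∎
    where open ≡-Reasoning

  *-cancelʳ-≢0 : ∀ {x y z} → x ≢ 0# → y * x ≡ z * x → y ≡ z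
  *-cancelʳ-≢0 {x} {y} {z} x≢0 yx≡zx = *-cancelˡ-≢0 x≢0 (trans (*-comm x y) (trans yx≡zx (*-comm z x)))

  x*y≡0⇒x≡0∨y≡0 : ∀ x y → x * y ≡ 0# → x ≡ 0# ⊎ y ≡ 0#
  x*y≡0⇒x≡0∨y≡0 x y xy≡0 with x ≟ 0#
  ... | yes x≡0 = inj₁ x≡0
  ... | no  x≢0 = inj₂ (*-cancelˡ-≢0 x≢0 (trans xy≡0 (sym (zeroʳ x))))

  *-≢0 : ∀ {x y} → x ≢ 0# → y ≢ 0# → x * y ≢ 0#
  *-≢0 {x} {y} x≢0 y≢0 xy≡0 with x*y≡0⇒x≡0∨y≡0 x y xy≡0
  ... | inj₁ x≡0 = x≢0 x≡0
  ... | inj₂ y≡0 = y≢0 y≡0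

  pow≗^ : ∀ x k → pow K x k ≡ x Exp.^ k
  pow≗^ x zero    = refl
  pow≗^ x (suc k) = cong (x *_) (pow≗^ x k)

  pow-+ : ∀ x a b → pow K x (a ℕ.+ b) ≡ pow K x a * pow K x b
  pow-+ x a b rewrite pow≗^ x (a ℕ.+ b) | pow≗^ x a | pow≗^ x b = Exp.^-homo-* x a b

  pow-* : ∀ x a b → pow K x (a ℕ.* b) ≡ pow K (pow K x a) b
  pow-* x a b rewrite pow≗^ (pow K x a) b | pow≗^ x a | pow≗^ x (a ℕ.* b) = sym (Exp.^-assocʳ x a b)

  pow-distrib-* : ∀ x y k → pow K (x * y) k ≡ pow K x k * pow K y k
  pow-distrib-* x y k rewrite pow≗^ (x * y) k | pow≗^ x k | pow≗^ y k = ^-distrib-* x y k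

  pow-pow-comm : ∀ x a b → pow K (pow K x a) b ≡ pow K (pow K x b) a
  pow-pow-comm x a b = trans (sym (pow-* x a b)) (trans (cong (pow K x) (ℕ.*-comm a b)) (pow-* x b a))

  pow-1# : ∀ k → pow K 1# k ≡ 1#
  pow-1# zero    = refl
  pow-1# (suc k) = trans (*-identityˡ _) (pow-1# k)

  pow-0# : ∀ {k} → 0 < k → pow K 0# k ≡ 0#
  pow-0# {suc k} _ = zeroˡ _

  pow-≢0 : ∀ {x} k → x ≢ 0# → pow K x k ≢ 0#
  pow-≢0 zero    x≢0 = 1#≢0#
  pow-≢0 (suc k) x≢0 = *-≢0 x≢0 (pow-≢0 k x≢0)

  pow≡1-∣ : ∀ {x d a} → d ∣ a → pow K x d ≡ 1# → pow K x a ≡ 1#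
  pow≡1-∣ {x} {d} (divides t refl) xᵈ≡1 = begin
    pow K x (t ℕ.* d)   ≡⟨ cong (pow K x) (ℕ.*-comm t d) ⟩
    pow K x (d ℕ.* t)   ≡⟨ pow-* x d t ⟩
    pow K (pow K x d) t ≡⟨ cong (λ y → pow K y t) xᵈ≡1 ⟩
    pow K 1# t          ≡⟨ pow-1# t ⟩
    1#                  ∎
    where open ≡-Reasoning

  pow≡1-cancel : ∀ {x g u} → pow K x (g ℕ.+ u) ≡ 1# → pow K x u ≡ 1# → pow K x g ≡ 1#
  pow≡1-cancel {x} {g} {u} xᵍ⁺ᵘ≡1 xᵘ≡1 = begin
    pow K x g             ≡⟨ *-identityʳ (pow K x g) ⟨
    pow K x g * 1#        ≡⟨ cong (pow K x g *_) xᵘ≡1 ⟨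
    pow K x g * pow K x u ≡⟨ pow-+ x g u ⟨
    pow K x (g ℕ.+ u)     ≡⟨ xᵍ⁺ᵘ≡1 ⟩
    1#                    ∎
    where open ≡-Reasoning

  pow≡1-gcd : ∀ {x} a b → pow K x a ≡ 1# → pow K x b ≡ 1# → pow K x (gcd a b) ≡ 1#
  pow≡1-gcd {x} a b xᵃ≡1 xᵇ≡1 with Bézout.identity (gcd-GCD a b)
  ... | Bézout.+- i j g+jb≡ia = pow≡1-cancel {g = gcd a b} {u = j ℕ.* b}
    (subst (λ k → pow K x k ≡ 1#) (sym g+jb≡ia) (pow≡1-∣ {x} (n∣m*n i) xᵃ≡1))
    (pow≡1-∣ {x} (n∣m*n j) xᵇ≡1)
  ... | Bézout.-+ i j g+ia≡jb = pow≡1-cancel {g = gcd a b} {u = i ℕ.* a}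
    (subst (λ k → pow K x k ≡ 1#) (sym g+ia≡jb) (pow≡1-∣ {x} (n∣m*n j) xᵇ≡1))
    (pow≡1-∣ {x} (n∣m*n i) xᵃ≡1)

  -- The units and Fermat's little theorem

  open Inverse enumeration using (to; from; strictlyInverseˡ)

  elements : List Carrier
  elements = tabulate to

  ∈-elements : ∀ x → x ∈ elements
  ∈-elements x = subst (_∈ elements) (strictlyInverseˡ x) (∈-tabulate⁺ (from x))

  elements-unique : Unique elements
  elements-unique = Unique.tabulate⁺ (Injection.injective (↔⇒↣ enumeration))

  ∃? : ∀ {P : Carrier → Set} → Decidable P → Dec (∃ P)
  ∃? P? = map′ satisfied (λ (x , px) → lose (∈-elements x) px) (any? P? elements)

  ≢0? : Decidable (_≢ 0#)
  ≢0? x = ¬? (x ≟ 0#)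

  units : List Carrier
  units = filter ≢0? elements

  ∈-units⁺ : ∀ {x} → x ≢ 0# → x ∈ units
  ∈-units⁺ {x} x≢0 = ∈-filter⁺ ≢0? (∈-elements x) x≢0

  ∈-units⁻ : ∀ {x} → x ∈ units → x ≢ 0#
  ∈-units⁻ x∈units = proj₂ (∈-filter⁻ ≢0? {xs = elements} x∈units)

  units-unique : Unique units
  units-unique = Unique.filter⁺ ≢0? elements-unique

  length-units : length units ≡ size ∸ 1
  length-units = cong (_∸ 1) (trans (sym (↭-length elements↭0∷units)) (length-tabulate to))
    where
    0∉units : All (0# ≢_) units
    0∉units = All.tabulate (λ x∈units 0≡x → ∈-units⁻ x∈units (sym 0≡x))
    zero-or-unit : ∀ {x} → x ∈ elements → x ∈ 0# ∷ units
    zero-or-unit {x} _ with x ≟ 0#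
    ... | yes refl = here refl
    ... | no  x≢0  = there (∈-units⁺ x≢0)
    elements↭0∷units : elements ↭ 0# ∷ units
    elements↭0∷units = ∼bag⇒↭ (unique∧set⇒bag elements-unique (0∉units ∷ units-unique)
                                              (mk⇔ zero-or-unit (λ _ → ∈-elements _)))

  0<q-1 : 0 < size ∸ 1
  0<q-1 = subst (0 <_) length-units (∈-length (∈-units⁺ 1#≢0#))

  product : List Carrier → Carrier
  product = foldr _*_ 1#

  product-↭ : ∀ {xs ys} → xs ↭ ys → product xs ≡ product ys
  product-↭ xs↭ys = foldr-commMonoid (setoid Carrier) *-isCommutativeMonoid (↭⇒↭ₛ xs↭ys)

  product-map-* : ∀ x ys → product (map (x *_) ys) ≡ pow K x (length ys) * product ys
  product-map-* x []       = sym (*-identityˡ 1#)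
  product-map-* x (y ∷ ys) = begin
    (x * y) * product (map (x *_) ys)            ≡⟨ cong ((x * y) *_) (product-map-* x ys) ⟩
    (x * y) * (pow K x (length ys) * product ys) ≡⟨ *-interchange x y _ _ ⟩
    (x * pow K x (length ys)) * (y * product ys) ∎
    where open ≡-Reasoning

  product-≢0 : ∀ {ys} → All (_≢ 0#) ys → product ys ≢ 0#
  product-≢0 []           = 1#≢0#
  product-≢0 (y≢0 ∷ ys≢0) = *-≢0 y≢0 (product-≢0 ys≢0)

  -- Multiplication by a unit permutes the units, so it fixes their product.
  fermat : ∀ {x} → x ≢ 0# → pow K x (size ∸ 1) ≡ 1#
  fermat {x} x≢0 = *-cancelˡ-≢0 (product-≢0 (All.tabulate ∈-units⁻)) (begin
    product units * pow K x (size ∸ 1)       ≡⟨ *-comm _ _ ⟩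
    pow K x (size ∸ 1) * product units       ≡⟨ cong (λ k → pow K x k * product units) length-units ⟨
    pow K x (length units) * product units   ≡⟨ product-map-* x units ⟨
    product (map (x *_) units)               ≡⟨ product-↭ x*units↭units ⟩
    product units                            ≡⟨ *-identityʳ _ ⟨
    product units * 1#                       ∎)
    where
    open ≡-Reasoning
    x*-preserves-units : ∀ {y} → y ∈ map (x *_) units → y ∈ units
    x*-preserves-units y∈ with ∈-map⁻ (x *_) y∈
    ... | z , z∈units , refl = ∈-units⁺ (*-≢0 x≢0 (∈-units⁻ z∈units))
    x*-reaches-units : ∀ {y} → y ∈ units → y ∈ map (x *_) units
    x*-reaches-units {y} y∈units with *-surjective x≢0 y
    ... | z , refl = ∈-map⁺ (x *_) (∈-units⁺ λ z≡0 → ∈-units⁻ y∈units (trans (cong (x *_) z≡0) (zeroʳ x)))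
    x*units↭units : map (x *_) units ↭ units
    x*units↭units = ∼bag⇒↭ (unique∧set⇒bag (Unique.map⁺ (*-cancelˡ-≢0 x≢0) units-unique) units-unique
                                            (mk⇔ x*-preserves-units x*-reaches-units))

  pow∈μ : ∀ {x b} a → x ≢ 0# → a ℕ.* b ≡ size ∸ 1 → μ K b (pow K x a)
  pow∈μ {x} {b} a x≢0 ab≡q-1 = trans (sym (pow-* x a b)) (trans (cong (pow K x) ab≡q-1) (fermat x≢0))

  μ-pow : ∀ {d ζ} k → μ K d ζ → μ K d (pow K ζ k)
  μ-pow {d} {ζ} k ζᵈ≡1 = trans (sym (pow-* ζ k d)) (pow≡1-∣ {ζ} (n∣m*n k) ζᵈ≡1)

  -- Polynomials and their roots

  eval-const : ∀ c x → eval K (c ∷ []) x ≡ c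
  eval-const c x = trans (cong (c +_) (zeroʳ x)) (+-identityʳ c)

  eval-at-0 : ∀ c cs → eval K (c ∷ cs) 0# ≡ c
  eval-at-0 c cs = trans (cong (c +_) (zeroˡ _)) (+-identityʳ c)

  eval-shiftPoly : ∀ k p x → eval K (shiftPoly K k p) x ≡ pow K x k * eval K p x
  eval-shiftPoly zero    p x = sym (*-identityˡ _)
  eval-shiftPoly (suc k) p x = begin
    0# + x * eval K (shiftPoly K k p) x ≡⟨ +-identityˡ _ ⟩
    x * eval K (shiftPoly K k p) x      ≡⟨ cong (x *_) (eval-shiftPoly k p x) ⟩
    x * (pow K x k * eval K p x)        ≡⟨ *-assoc x _ _ ⟨
    pow K x (suc k) * eval K p x        ∎
    where open ≡-Reasoning

  length-shiftPoly : ∀ k p → length (shiftPoly K k p) ≡ k ℕ.+ length p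
  length-shiftPoly k p = trans (length-++ (replicate k 0#)) (cong (ℕ._+ length p) (length-replicate k))

  eval-substPow : ∀ {e} → 0 < e → ∀ h x → eval K (substPow K e h) x ≡ eval K h (pow K x e)
  eval-substPow         _   []       x = refl
  eval-substPow {suc e} 0<e (c ∷ cs) x = cong (c +_) (begin
    x * eval K (shiftPoly K e (substPow K (suc e) cs)) x ≡⟨ cong (x *_) (eval-shiftPoly e _ x) ⟩
    x * (pow K x e * eval K (substPow K (suc e) cs) x)  ≡⟨ *-assoc x _ _ ⟨
    pow K x (suc e) * eval K (substPow K (suc e) cs) x  ≡⟨ cong (pow K x (suc e) *_) (eval-substPow 0<e cs x) ⟩
    pow K x (suc e) * eval K cs (pow K x (suc e))       ∎)
    where open ≡-Reasoning

  eval-vanishing : ∀ p → (∀ i → coeff K p i ≡ 0#) → ∀ x → eval K p x ≡ 0#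
  eval-vanishing []       _     x = refl
  eval-vanishing (c ∷ cs) cs≡0 x = begin
    c + x * eval K cs x ≡⟨ cong₂ (λ a b → a + x * b) (cs≡0 0) (eval-vanishing cs (cs≡0 ∘ suc) x) ⟩
    0# + x * 0#         ≡⟨ trans (+-identityˡ _) (zeroʳ x) ⟩
    0#                  ∎
    where open ≡-Reasoning

  eval-≈ₚ : ∀ p r → _≈ₚ_ K p r → ∀ x → eval K p x ≡ eval K r x
  eval-≈ₚ []       []       _   x = refl
  eval-≈ₚ []       (d ∷ ds) p≈r x = sym (eval-vanishing (d ∷ ds) (sym ∘ p≈r) x)
  eval-≈ₚ (c ∷ cs) []       p≈r x = eval-vanishing (c ∷ cs) p≈r x
  eval-≈ₚ (c ∷ cs) (d ∷ ds) p≈r x = cong₂ (λ a b → a + x * b) (p≈r 0) (eval-≈ₚ cs ds (p≈r ∘ suc) x)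

  quotient : Carrier → Poly K → Poly K
  quotient r []            = []
  quotient r (c ∷ [])      = []
  quotient r (c ∷ c′ ∷ cs) = eval K (c′ ∷ cs) r ∷ quotient r (c′ ∷ cs)

  length-quotient : ∀ r p → length (quotient r p) ≡ length p ∸ 1
  length-quotient r []            = refl
  length-quotient r (c ∷ [])      = refl
  length-quotient r (c ∷ c′ ∷ cs) = cong suc (length-quotient r (c′ ∷ cs))

  r+[x-r]≡x : ∀ r x → r + (x - r) ≡ x
  r+[x-r]≡x r x = trans (sym (+-assoc r x (- r))) (xyx⁻¹≈y r x)

  private
    horner-step : ∀ c r u P Q → c + (r + u) * (P + u * Q) ≡ (c + r * P) + u * (P + (r + u) * Q)
    horner-step = solve 5 (λ c r u P Q → c :+ (r :+ u) :* (P :+ u :* Q) := (c :+ r :* P) :+ u :* (P :+ (r :+ u) :* Q)) refl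

  eval-quotient : ∀ r p x → eval K p x ≡ eval K p r + (x - r) * eval K (quotient r p) x
  eval-quotient r []            x = sym (trans (+-identityˡ _) (zeroʳ (x - r)))
  eval-quotient r (c ∷ [])      x = begin
    eval K (c ∷ []) x                ≡⟨ eval-const c x ⟩
    c                                ≡⟨ +-identityʳ c ⟨
    c + 0#                           ≡⟨ cong₂ _+_ (eval-const c r) (zeroʳ (x - r)) ⟨
    eval K (c ∷ []) r + (x - r) * 0# ∎
    where open ≡-Reasoning
  eval-quotient r (c ∷ P@(_ ∷ _)) x = begin
    c + x * eval K P x                      ≡⟨ cong (λ t → c + x * t) (eval-quotient r P x) ⟩
    c + x * (Pr + u * Qx)                   ≡⟨ cong (λ y → c + y * (Pr + u * Qx)) (r+[x-r]≡x r x) ⟨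
    c + (r + u) * (Pr + u * Qx)             ≡⟨ horner-step c r u Pr Qx ⟩
    (c + r * Pr) + u * (Pr + (r + u) * Qx)  ≡⟨ cong (λ y → (c + r * Pr) + u * (Pr + y * Qx)) (r+[x-r]≡x r x) ⟩
    (c + r * Pr) + u * (Pr + x * Qx)        ∎
    where
    open ≡-Reasoning
    u  = x - r
    Pr = eval K P r
    Qx = eval K (quotient r P) x

  Root : Poly K → Carrier → Set
  Root p r = eval K p r ≡ 0#

  root-quotient : ∀ {p r s} → Root p r → Root p s → r ≢ s → Root (quotient r p) s
  root-quotient {p} {r} {s} pr≡0 ps≡0 r≢s with x*y≡0⇒x≡0∨y≡0 (s - r) (eval K (quotient r p) s) [s-r]q≡0
    where
    [s-r]q≡0 : (s - r) * eval K (quotient r p) s ≡ 0#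
    [s-r]q≡0 = begin
      (s - r) * q              ≡⟨ +-identityˡ _ ⟨
      0# + (s - r) * q         ≡⟨ cong (λ t → t + (s - r) * q) pr≡0 ⟨
      eval K p r + (s - r) * q ≡⟨ eval-quotient r p s ⟨
      eval K p s               ≡⟨ ps≡0 ⟩
      0#                       ∎
      where
      open ≡-Reasoning
      q = eval K (quotient r p) s
  ... | inj₁ s-r≡0 = ⊥-elim (r≢s (sym (x∙y⁻¹≈ε⇒x≈y s r s-r≡0)))
  ... | inj₂ qs≡0  = qs≡0

  roots⇒vanishing : ∀ p {rs} → Unique rs → All (Root p) rs → length p ≤ length rs → ∀ x → Root p x
  roots⇒vanishing []  {[]}     _                  _              _    x = refl
  roots⇒vanishing p   {r ∷ rs} (r∉rs ∷ rs-unique) (pr≡0 ∷ prs≡0) len≤ x = begin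
    eval K p x                                     ≡⟨ eval-quotient r p x ⟩
    eval K p r + (x - r) * eval K (quotient r p) x ≡⟨ cong₂ (λ a b → a + (x - r) * b) pr≡0 qx≡0 ⟩
    0# + (x - r) * 0#                              ≡⟨ trans (+-identityˡ _) (zeroʳ (x - r)) ⟩
    0#                                             ∎
    where
    open ≡-Reasoning
    qx≡0 : Root (quotient r p) x
    qx≡0 = roots⇒vanishing (quotient r p) rs-unique
      (All.zipWith (λ (r≢s , ps≡0) → root-quotient {p} pr≡0 ps≡0 r≢s) (r∉rs , prs≡0))
      (subst (_≤ length rs) (sym (length-quotient r p)) (ℕ.∸-monoˡ-≤ 1 len≤)) x

  length-roots<length : ∀ p {rs} x₀ → Unique rs → All (Root p) rs → eval K p x₀ ≢ 0# → length rs < length p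
  length-roots<length p x₀ rs-unique all-roots px₀≢0 =
    ℕ.≰⇒> λ len≤ → px₀≢0 (roots⇒vanishing p rs-unique all-roots len≤ x₀)

  -- Roots of unity

  μ? : ∀ d → Decidable (μ K d)
  μ? d x = pow K x d ≟ 1#

  μ⇒≢0 : ∀ {d x} → 0 < d → μ K d x → x ≢ 0#
  μ⇒≢0 0<d xᵈ≡1 refl = 1#≢0# (trans (sym xᵈ≡1) (pow-0# 0<d))

  rootsOfUnity : ℕ → List Carrier
  rootsOfUnity d = filter (μ? d) units

  rootsOfUnity-unique : ∀ d → Unique (rootsOfUnity d)
  rootsOfUnity-unique d = Unique.filter⁺ (μ? d) units-unique

  ∈-rootsOfUnity⁺ : ∀ {d x} → 0 < d → μ K d x → x ∈ rootsOfUnity d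
  ∈-rootsOfUnity⁺ {d} 0<d xᵈ≡1 = ∈-filter⁺ (μ? d) (∈-units⁺ (μ⇒≢0 0<d xᵈ≡1)) xᵈ≡1

  ∈-rootsOfUnity⁻ : ∀ {d x} → x ∈ rootsOfUnity d → μ K d x
  ∈-rootsOfUnity⁻ {d} x∈μ = proj₂ (∈-filter⁻ (μ? d) {xs = units} x∈μ)

  x^[1+d]-1 : ℕ → Poly K
  x^[1+d]-1 d = - 1# ∷ shiftPoly K d (1# ∷ [])

  eval-x^[1+d]-1 : ∀ d x → eval K (x^[1+d]-1 d) x ≡ - 1# + pow K x (suc d)
  eval-x^[1+d]-1 d x = cong (- 1# +_) (begin
    x * eval K (shiftPoly K d (1# ∷ [])) x ≡⟨ cong (x *_) (eval-shiftPoly d (1# ∷ []) x) ⟩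
    x * (pow K x d * eval K (1# ∷ []) x)   ≡⟨ cong (λ c → x * (pow K x d * c)) (eval-const 1# x) ⟩
    x * (pow K x d * 1#)                   ≡⟨ cong (x *_) (*-identityʳ _) ⟩
    pow K x (suc d)                        ∎)
    where open ≡-Reasoning

  length-rootsOfUnity≤ : ∀ d → length (rootsOfUnity (suc d)) ≤ suc d
  length-rootsOfUnity≤ d = ℕ.≤-pred (begin-strict
    length (rootsOfUnity (suc d)) <⟨ length-roots<length (x^[1+d]-1 d) 0# (rootsOfUnity-unique (suc d))
                                                         (All.tabulate is-root) x^[1+d]-1[0]≢0 ⟩
    length (x^[1+d]-1 d)          ≡⟨ cong suc (length-shiftPoly d (1# ∷ [])) ⟩
    suc (d ℕ.+ 1)                 ≡⟨ cong suc (ℕ.+-comm d 1) ⟩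
    suc (suc d)                   ∎)
    where
    open ℕ.≤-Reasoning
    x^[1+d]-1[0]≢0 : eval K (x^[1+d]-1 d) 0# ≢ 0#
    x^[1+d]-1[0]≢0 p0≡0 = -1#≢0# (trans (sym (eval-at-0 (- 1#) (shiftPoly K d (1# ∷ [])))) p0≡0)
    is-root : ∀ {x} → x ∈ rootsOfUnity (suc d) → Root (x^[1+d]-1 d) x
    is-root {x} x∈μ = trans (eval-x^[1+d]-1 d x) (trans (cong (- 1# +_) (∈-rootsOfUnity⁻ {suc d} x∈μ)) (-‿inverseˡ 1#))

  geometricSum : ℕ → Carrier → Carrier
  geometricSum zero    y = 1#
  geometricSum (suc t) y = 1# + y * geometricSum t y

  private
    telescope-step : ∀ y p s → y * p + (1# + y * s) ≡ 1# + y * (p + s)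
    telescope-step = solve 3 (λ y p s → y :* p :+ (con 1 :+ y :* s) := con 1 :+ y :* (p :+ s)) refl

  geometricSum-telescope : ∀ t y → pow K y (suc t) + geometricSum t y ≡ 1# + y * geometricSum t y
  geometricSum-telescope zero    y = +-comm _ 1#
  geometricSum-telescope (suc t) y = begin
    y * pow K y (suc t) + (1# + y * geometricSum t y) ≡⟨ telescope-step y _ _ ⟩
    1# + y * (pow K y (suc t) + geometricSum t y)     ≡⟨ cong (λ s → 1# + y * s) (geometricSum-telescope t y) ⟩
    1# + y * geometricSum (suc t) y                   ∎
    where open ≡-Reasoning

  geometricSum-root : ∀ t y → pow K y (suc t) ≡ 1# → y ≢ 1# → geometricSum t y ≡ 0#
  geometricSum-root t y y^[1+t]≡1 y≢1 with geometricSum t y ≟ 0#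
  ... | yes s≡0 = s≡0
  ... | no  s≢0 = ⊥-elim (y≢1 (*-cancelʳ-≢0 s≢0 (trans (sym s≡ys) (sym (*-identityˡ _)))))
    where
    s≡ys : geometricSum t y ≡ y * geometricSum t y
    s≡ys = +-cancelˡ 1# _ _ (trans (cong (_+ geometricSum t y) (sym y^[1+t]≡1)) (geometricSum-telescope t y))

  geometric : ℕ → ℕ → Poly K
  geometric d zero    = 1# ∷ []
  geometric d (suc t) = 1# ∷ shiftPoly K d (geometric d t)

  eval-geometric : ∀ d t x → eval K (geometric d t) x ≡ geometricSum t (pow K x (suc d))
  eval-geometric d zero    x = eval-const 1# x
  eval-geometric d (suc t) x = cong (1# +_) (begin
    x * eval K (shiftPoly K d (geometric d t)) x ≡⟨ cong (x *_) (eval-shiftPoly d _ x) ⟩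
    x * (pow K x d * eval K (geometric d t) x)  ≡⟨ *-assoc x _ _ ⟨
    pow K x (suc d) * eval K (geometric d t) x  ≡⟨ cong (pow K x (suc d) *_) (eval-geometric d t x) ⟩
    pow K x (suc d) * geometricSum t (pow K x (suc d)) ∎)
    where open ≡-Reasoning

  geometric-at-0 : ∀ d t → eval K (geometric d t) 0# ≡ 1#
  geometric-at-0 d zero    = eval-at-0 1# []
  geometric-at-0 d (suc t) = eval-at-0 1# (shiftPoly K d (geometric d t))

  length-geometric : ∀ d t → length (geometric d t) ≡ suc (t ℕ.* suc d)
  length-geometric d zero    = refl
  length-geometric d (suc t) = cong suc (trans (length-shiftPoly d (geometric d t))
                                                (trans (cong (d ℕ.+_) (length-geometric d t)) (ℕ.+-suc d _)))

  -- A unit outside μ_(d+1) is a root of 1 + y + ⋯ + y^t in y = x^(d+1), a polynomial with t(d+1) + 1 coefficients.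
  length-rootsOfUnity≥ : ∀ d t → size ∸ 1 ≡ suc t ℕ.* suc d → suc d ≤ length (rootsOfUnity (suc d))
  length-rootsOfUnity≥ d t q-1≡[1+t][1+d] = ℕ.+-cancelʳ-≤ (t ℕ.* suc d) (suc d) #μ (begin
    suc d ℕ.+ t ℕ.* suc d   ≡⟨ trans (sym q-1≡[1+t][1+d]) (sym length-units) ⟩
    length units            ≡⟨ length-filter+length-filter-∁ (μ? (suc d)) units ⟨
    #μ ℕ.+ length others    ≤⟨ ℕ.+-monoʳ-≤ #μ length-others≤ ⟩
    #μ ℕ.+ t ℕ.* suc d      ∎)
    where
    open ℕ.≤-Reasoning
    #μ = length (rootsOfUnity (suc d))
    others : List Carrier
    others = filter (∁? (μ? (suc d))) units
    [1+d][1+t]≡q-1 : suc d ℕ.* suc t ≡ size ∸ 1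
    [1+d][1+t]≡q-1 = trans (ℕ.*-comm (suc d) (suc t)) (sym q-1≡[1+t][1+d])
    is-root : ∀ {x} → x ∈ others → Root (geometric d t) x
    is-root {x} x∈others with ∈-filter⁻ (∁? (μ? (suc d))) {xs = units} x∈others
    ... | x∈units , x∉μ = trans (eval-geometric d t x)
      (geometricSum-root t (pow K x (suc d)) (pow∈μ (suc d) (∈-units⁻ x∈units) [1+d][1+t]≡q-1) x∉μ)
    length-others≤ : length others ≤ t ℕ.* suc d
    length-others≤ = ℕ.≤-pred (subst (length others <_) (length-geometric d t)
      (length-roots<length (geometric d t) 0# (Unique.filter⁺ (∁? (μ? (suc d))) units-unique)
                           (All.tabulate is-root) (λ g0≡0 → 1#≢0# (trans (sym (geometric-at-0 d t)) g0≡0))))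

  length-rootsOfUnity : ∀ {d} → d ∣ size ∸ 1 → 0 < d → length (rootsOfUnity d) ≡ d
  length-rootsOfUnity {suc d} (divides zero    q-1≡0)   _ = ⊥-elim (ℕ.<⇒≢ 0<q-1 (sym q-1≡0))
  length-rootsOfUnity {suc d} (divides (suc t) q-1≡td) _ =
    ℕ.≤-antisym (length-rootsOfUnity≤ d) (length-rootsOfUnity≥ d t q-1≡td)

  ∈-coset⇔ : ∀ {x d c} → 0 < d → c ∈ map (x *_) (rootsOfUnity d) ⇔ ∃ λ ζ → μ K d ζ × x * ζ ≡ c
  ∈-coset⇔ {x} {d} 0<d = mk⇔ into onto
    where
    into : ∀ {c} → c ∈ map (x *_) (rootsOfUnity d) → ∃ λ ζ → μ K d ζ × x * ζ ≡ c
    into c∈ with ∈-map⁻ (x *_) c∈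
    ... | ζ , ζ∈μ , refl = ζ , ∈-rootsOfUnity⁻ {d} ζ∈μ , refl
    onto : ∀ {c} → (∃ λ ζ → μ K d ζ × x * ζ ≡ c) → c ∈ map (x *_) (rootsOfUnity d)
    onto (ζ , ζᵈ≡1 , refl) = ∈-map⁺ (x *_) (∈-rootsOfUnity⁺ 0<d ζᵈ≡1)

  -- Dynamics of f

  walk⇔iterate : ∀ f {k c b} → Walk (FunctionalGraph K f) k c b ⇔ iterate (eval K f) k c ≡ b
  walk⇔iterate f = mk⇔ walk⇒iterate (iterate⇒walk _ _ _)
    where
    walk⇒iterate : ∀ {k c b} → Walk (FunctionalGraph K f) k c b → iterate (eval K f) k c ≡ b
    walk⇒iterate (here _)        = refl
    walk⇒iterate (step _ refl w) = walk⇒iterate w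
    iterate⇒walk : ∀ k c b → iterate (eval K f) k c ≡ b → Walk (FunctionalGraph K f) k c b
    iterate⇒walk zero    c .c refl = here tt
    iterate⇒walk (suc k) c b fᵏ⁺¹c≡b = step tt refl (iterate⇒walk k (eval K f c) b fᵏ⁺¹c≡b)

  module Dynamics (m e : ℕ) (e*m≡q-1 : e ℕ.* m ≡ size ∸ 1) (n : ℕ) (0<n : 0 < n)
                  (f h : Poly K) (rep : Rep K f e n h) (nice : Nice K m e n h) where

    F : Carrier → Carrier
    F = eval K f

    0<e : 0 < e
    0<e = ℕ.n≢0⇒n>0 λ e≡0 → ℕ.<⇒≢ 0<q-1 (trans (cong (ℕ._* m) (sym e≡0)) e*m≡q-1)

    F-form : ∀ x → F x ≡ pow K x n * eval K h (pow K x e)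
    F-form x = begin
      eval K f x                                       ≡⟨ eval-≈ₚ f (shiftPoly K n (substPow K e h)) (proj₂ rep) x ⟩
      eval K (shiftPoly K n (substPow K e h)) x        ≡⟨ eval-shiftPoly n _ x ⟩
      pow K x n * eval K (substPow K e h) x            ≡⟨ cong (pow K x n *_) (eval-substPow 0<e h x) ⟩
      pow K x n * eval K h (pow K x e)                 ∎
      where open ≡-Reasoning

    F-0 : F 0# ≡ 0#
    F-0 = trans (F-form 0#) (trans (cong (_* eval K h (pow K 0# e)) (pow-0# 0<n)) (zeroˡ _))

    F-twist : ∀ {ζ} x → μ K e ζ → F (ζ * x) ≡ pow K ζ n * F x
    F-twist {ζ} x ζᵉ≡1 = begin
      F (ζ * x)                             ≡⟨ F-form (ζ * x) ⟩
      pow K (ζ * x) n * H (pow K (ζ * x) e) ≡⟨ cong₂ (λ a b → a * H b) (pow-distrib-* ζ x n) (pow-distrib-* ζ x e) ⟩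
      (ζⁿ * xⁿ) * H (pow K ζ e * xᵉ)        ≡⟨ cong (λ t → (ζⁿ * xⁿ) * H (t * xᵉ)) ζᵉ≡1 ⟩
      (ζⁿ * xⁿ) * H (1# * xᵉ)               ≡⟨ cong (λ t → (ζⁿ * xⁿ) * H t) (*-identityˡ xᵉ) ⟩
      (ζⁿ * xⁿ) * H xᵉ                      ≡⟨ *-assoc ζⁿ xⁿ (H xᵉ) ⟩
      ζⁿ * (xⁿ * H xᵉ)                      ≡⟨ cong (ζⁿ *_) (F-form x) ⟨
      ζⁿ * F x                              ∎
      where
      open ≡-Reasoning
      H = eval K h
      ζⁿ = pow K ζ n
      xⁿ = pow K x n
      xᵉ = pow K x e

    F-pow-e : ∀ x → pow K (F x) e ≡ psi K e n h (pow K x e)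
    F-pow-e x = begin
      pow K (F x) e                         ≡⟨ cong (λ y → pow K y e) (F-form x) ⟩
      pow K (pow K x n * H xᵉ) e            ≡⟨ pow-distrib-* (pow K x n) (H xᵉ) e ⟩
      pow K (pow K x n) e * pow K (H xᵉ) e  ≡⟨ cong (_* pow K (H xᵉ) e) (pow-pow-comm x n e) ⟩
      pow K xᵉ n * pow K (H xᵉ) e           ∎
      where
      open ≡-Reasoning
      H = eval K h
      xᵉ = pow K x e

    iterate-0 : ∀ k → iterate F k 0# ≡ 0#
    iterate-0 zero    = refl
    iterate-0 (suc k) = trans (cong (iterate F k) F-0) (iterate-0 k)

    iterate≢0⇒≢0 : ∀ k {x} → iterate F k x ≢ 0# → x ≢ 0#
    iterate≢0⇒≢0 k Fᵏx≢0 refl = Fᵏx≢0 (iterate-0 k)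

    iterate-twist : ∀ k {ζ} x → μ K e ζ → iterate F k (ζ * x) ≡ pow K ζ (n ℕ.^ k) * iterate F k x
    iterate-twist zero    {ζ} x _    = cong (_* x) (sym (*-identityʳ ζ))
    iterate-twist (suc k) {ζ} x ζᵉ≡1 = begin
      iterate F k (F (ζ * x))                         ≡⟨ cong (iterate F k) (F-twist x ζᵉ≡1) ⟩
      iterate F k (pow K ζ n * F x)                   ≡⟨ iterate-twist k (F x) (μ-pow {e} n ζᵉ≡1) ⟩
      pow K (pow K ζ n) (n ℕ.^ k) * iterate F k (F x) ≡⟨ cong (_* iterate F k (F x)) (pow-* ζ n (n ℕ.^ k)) ⟨
      pow K ζ (n ℕ.^ suc k) * iterate F k (F x)       ∎
      where open ≡-Reasoning

    -- F(x)^e = ψ(x^e) with x^e ∈ μ_m, and niceness makes ψ injective there off its zeros.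
    iterate-injective-pow : ∀ k {x y} → iterate F k x ≡ iterate F k y → iterate F k x ≢ 0# → pow K x e ≡ pow K y e
    iterate-injective-pow zero    Fᵏx≡Fᵏy _ = cong (λ z → pow K z e) Fᵏx≡Fᵏy
    iterate-injective-pow (suc k) {x} {y} Fᵏx≡Fᵏy Fᵏx≢0 =
      proj₂ nice (pow K x e) (pow K y e) (pow-e∈μ Fᵏx≢0) (pow-e∈μ Fᵏy≢0) (ψ≢0 Fᵏx≢0) (ψ≢0 Fᵏy≢0)
        (trans (sym (F-pow-e x)) (trans (iterate-injective-pow k Fᵏx≡Fᵏy Fᵏx≢0) (F-pow-e y)))
      where
      Fᵏy≢0 : iterate F (suc k) y ≢ 0#
      Fᵏy≢0 = Fᵏx≢0 ∘ trans Fᵏx≡Fᵏy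
      pow-e∈μ : ∀ {z} → iterate F (suc k) z ≢ 0# → μ K m (pow K z e)
      pow-e∈μ Fᵏz≢0 = pow∈μ e (iterate≢0⇒≢0 (suc k) Fᵏz≢0) e*m≡q-1
      ψ≢0 : ∀ {z} → iterate F (suc k) z ≢ 0# → psi K e n h (pow K z e) ≢ 0#
      ψ≢0 {z} Fᵏz≢0 = subst (_≢ 0#) (F-pow-e z) (pow-≢0 e (iterate≢0⇒≢0 k Fᵏz≢0))

    fibre-as-coset : ∀ k {x₀ b} → iterate F k x₀ ≡ b → b ≢ 0# →
                     ∀ c → (∃ λ ζ → μ K (gcd e (n ℕ.^ k)) ζ × x₀ * ζ ≡ c) ⇔ iterate F k c ≡ b
    fibre-as-coset k {x₀} {b} Fᵏx₀≡b b≢0 c = mk⇔ coset⇒fibre fibre⇒coset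
      where
      open ≡-Reasoning
      x₀≢0 : x₀ ≢ 0#
      x₀≢0 = iterate≢0⇒≢0 k (b≢0 ∘ trans (sym Fᵏx₀≡b))
      coset⇒fibre : (∃ λ ζ → μ K (gcd e (n ℕ.^ k)) ζ × x₀ * ζ ≡ c) → iterate F k c ≡ b
      coset⇒fibre (ζ , ζᵍ≡1 , refl) = begin
        iterate F k (x₀ * ζ)                  ≡⟨ cong (iterate F k) (*-comm x₀ ζ) ⟩
        iterate F k (ζ * x₀)                  ≡⟨ iterate-twist k x₀ (pow≡1-∣ {ζ} (gcd[m,n]∣m e (n ℕ.^ k)) ζᵍ≡1) ⟩
        pow K ζ (n ℕ.^ k) * iterate F k x₀    ≡⟨ cong₂ _*_ (pow≡1-∣ {ζ} (gcd[m,n]∣n e (n ℕ.^ k)) ζᵍ≡1) Fᵏx₀≡b ⟩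
        1# * b                                ≡⟨ *-identityˡ b ⟩
        b                                     ∎
      fibre⇒coset : iterate F k c ≡ b → ∃ λ ζ → μ K (gcd e (n ℕ.^ k)) ζ × x₀ * ζ ≡ c
      fibre⇒coset Fᵏc≡b with *-surjective x₀≢0 c
      ... | ζ , refl = ζ , pow≡1-gcd e (n ℕ.^ k) ζᵉ≡1 ζⁿ^ᵏ≡1 , refl
        where
        ζᵉ≡1 : pow K ζ e ≡ 1#
        ζᵉ≡1 = *-cancelˡ-≢0 (pow-≢0 e x₀≢0) (begin
          pow K x₀ e * pow K ζ e   ≡⟨ pow-distrib-* x₀ ζ e ⟨
          pow K (x₀ * ζ) e         ≡⟨ iterate-injective-pow k (trans Fᵏc≡b (sym Fᵏx₀≡b)) (b≢0 ∘ trans (sym Fᵏc≡b)) ⟩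
          pow K x₀ e               ≡⟨ *-identityʳ _ ⟨
          pow K x₀ e * 1#          ∎)
        ζⁿ^ᵏ≡1 : pow K ζ (n ℕ.^ k) ≡ 1#
        ζⁿ^ᵏ≡1 = *-cancelʳ-≢0 b≢0 (begin
          pow K ζ (n ℕ.^ k) * b                ≡⟨ cong (pow K ζ (n ℕ.^ k) *_) Fᵏx₀≡b ⟨
          pow K ζ (n ℕ.^ k) * iterate F k x₀   ≡⟨ iterate-twist k x₀ ζᵉ≡1 ⟨
          iterate F k (ζ * x₀)                 ≡⟨ cong (iterate F k) (*-comm ζ x₀) ⟩
          iterate F k (x₀ * ζ)                 ≡⟨ Fᵏc≡b ⟩
          b                                    ≡⟨ *-identityˡ b ⟨
          1# * b                               ∎)

    GF : DiGraph
    GF = FunctionalGraph K f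

    coset-count : ∀ {x₀ d} → x₀ ≢ 0# → d ∣ size ∸ 1 → 0 < d →
                  Count GF (λ c → ∃ λ ζ → μ K d ζ × x₀ * ζ ≡ c) d
    coset-count {x₀} {d} x₀≢0 d∣q-1 0<d =
      map (x₀ *_) (rootsOfUnity d) ,
      Unique.map⁺ (*-cancelˡ-≢0 x₀≢0) (rootsOfUnity-unique d) ,
      trans (length-map (x₀ *_) (rootsOfUnity d)) (length-rootsOfUnity d∣q-1 0<d) ,
      λ c → Equivalence.to (∈-coset⇔ 0<d) , Equivalence.from (∈-coset⇔ 0<d)

    fibre-count : ∀ k {x₀ b} → iterate F k x₀ ≡ b → b ≢ 0# →
                  Count GF (λ c → iterate F k c ≡ b) (gcd e (n ℕ.^ k))
    fibre-count k {x₀} Fᵏx₀≡b b≢0 = Count-cong GF (fibre-as-coset k Fᵏx₀≡b b≢0) (coset-count x₀≢0 g∣q-1 0<g)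
      where
      x₀≢0 : x₀ ≢ 0#
      x₀≢0 = iterate≢0⇒≢0 k (b≢0 ∘ trans (sym Fᵏx₀≡b))
      g∣q-1 : gcd e (n ℕ.^ k) ∣ size ∸ 1
      g∣q-1 = ∣-trans (gcd[m,n]∣m e (n ℕ.^ k)) (subst (e ∣_) e*m≡q-1 (m∣m*n m))
      0<g : 0 < gcd e (n ℕ.^ k)
      0<g = ℕ.n≢0⇒n>0 (gcd[m,n]≢0 e (n ℕ.^ k) (inj₁ (ℕ.>⇒≢ 0<e)))

    R-count : ∀ {a} → a ≢ 0# → ∀ {b} → DiGraph.Vertex (R GF a) b → ∀ k →
              Count (R GF a) (λ c → Walk (R GF a) k c b) 0 ⊎
              Count (R GF a) (λ c → Walk (R GF a) k c b) (gcd e (n ℕ.^ k))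
    R-count {a} a≢0 {b} (_ , b≺a@(j , b⇝a)) k with ∃? (λ c → iterate F k c ≟ b)
    ... | no  ∄x₀ = inj₁ (Count-none (R GF a) λ c w → ∄x₀ (c , Equivalence.to (walk⇔iterate f) (unrestrict w)))
    ... | yes (x₀ , Fᵏx₀≡b) = inj₂ (Count-cong (R GF a) walk⇔fibre (fibre-count k Fᵏx₀≡b b≢0))
      where
      b≢0 : b ≢ 0#
      b≢0 refl = a≢0 (trans (sym (Equivalence.to (walk⇔iterate f) b⇝a)) (iterate-0 j))
      walk⇔fibre : ∀ c → iterate F k c ≡ b ⇔ Walk (R GF a) k c b
      walk⇔fibre c = mk⇔ (restrict b≺a ∘ Equivalence.from (walk⇔iterate f))
                         (Equivalence.to (walk⇔iterate f) ∘ unrestrict)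

-- The sequence gcd_n(v)

-- ℕ's _+_ and _*_ are opened only from here on, as they would clash with the field operations above.
open import Data.Nat using (_+_; _*_; _^_)
open import Data.Nat.Properties
  using (+-identityʳ; +-suc; +-comm; *-comm; *-identityˡ; *-cancelʳ-≡; ≤-trans; <-≤-trans; <-irrefl; <⇒≤; >⇒≢;
         m≤n⇒m<n∨m≡n; m<1+n⇒m≤n; m<n⇒m<1+n; n<1+n; n≢0⇒n>0; m≤m+n; +-monoʳ-≤; *-monoˡ-≤; module ≤-Reasoning)

prodUpTo-cong : ∀ {f g} → (∀ i → f (suc i) ≡ g (suc i)) → ∀ k → prodUpTo f k ≡ prodUpTo g k
prodUpTo-cong f≗g zero    = refl
prodUpTo-cong f≗g (suc k) = cong₂ _*_ (prodUpTo-cong f≗g k) (f≗g k)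

extend-head : ∀ a vs → extend (a ∷ vs) 1 ≡ a
extend-head a []      = refl
extend-head a (_ ∷ _) = refl

extend-tail : ∀ a vs i → vs ≢ [] → extend (a ∷ vs) (suc (suc i)) ≡ extend vs (suc i)
extend-tail a []      i vs≢[] = ⊥-elim (vs≢[] refl)
extend-tail a (_ ∷ _) i _     = refl

module GcdSequence (n v : ℕ) (0<v : 0 < v) where

  gcdPow : ℕ → ℕ
  gcdPow i = gcd (n ^ i) v

  ratio : ℕ → ℕ
  ratio = gcdRatio n v

  gcdPow≢0 : ∀ i → gcdPow i ≢ 0
  gcdPow≢0 i = gcd[m,n]≢0 (n ^ i) v (inj₂ (>⇒≢ 0<v))

  gcdPow∣gcdPow-suc : ∀ i → gcdPow i ∣ gcdPow (suc i)
  gcdPow∣gcdPow-suc i = gcd-greatest (∣-trans (gcd[m,n]∣m (n ^ i) v) (n∣m*n n)) (gcd[m,n]∣n (n ^ i) v)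

  ratio*gcdPow : ∀ i → ratio (suc i) * gcdPow i ≡ gcdPow (suc i)
  ratio*gcdPow i with gcdPow i | gcdPow≢0 i | gcdPow∣gcdPow-suc i
  ... | zero  | g≢0 | _   = ⊥-elim (g≢0 refl)
  ... | suc _ | _   | g∣g′ = m/n*n≡m g∣g′

  prodUpTo-ratio : ∀ k → prodUpTo ratio k ≡ gcdPow k
  prodUpTo-ratio zero    = sym (gcd-zeroˡ v)
  prodUpTo-ratio (suc k) = begin
    prodUpTo ratio k * ratio (suc k) ≡⟨ cong (_* ratio (suc k)) (prodUpTo-ratio k) ⟩
    gcdPow k * ratio (suc k)         ≡⟨ *-comm (gcdPow k) _ ⟩
    ratio (suc k) * gcdPow k         ≡⟨ ratio*gcdPow k ⟩
    gcdPow (suc k)                   ∎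
    where open ≡-Reasoning

  ratio≡1⇒stable : ∀ i → ratio (suc i) ≡ 1 → gcdPow (suc i) ≡ gcdPow i
  ratio≡1⇒stable i r≡1 = begin
    gcdPow (suc i)           ≡⟨ ratio*gcdPow i ⟨
    ratio (suc i) * gcdPow i ≡⟨ cong (_* gcdPow i) r≡1 ⟩
    1 * gcdPow i             ≡⟨ *-identityˡ (gcdPow i) ⟩
    gcdPow i                 ∎
    where open ≡-Reasoning

  stable⇒ratio≡1 : ∀ i → gcdPow (suc i) ≡ gcdPow i → ratio (suc i) ≡ 1
  stable⇒ratio≡1 i g′≡g = *-cancelʳ-≡ (ratio (suc i)) 1 (gcdPow i) {{≢-nonZero (gcdPow≢0 i)}}
    (trans (ratio*gcdPow i) (trans g′≡g (sym (*-identityˡ (gcdPow i)))))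

  -- gcd(n^(i+2), v) divides n·gcd(n^(i+1), v) = n·gcd(n^i, v), a divisor of n^(i+1).
  stable-suc : ∀ i → gcdPow (suc i) ≡ gcdPow i → gcdPow (suc (suc i)) ≡ gcdPow (suc i)
  stable-suc i g′≡g = ∣-antisym g″∣g′ (gcdPow∣gcdPow-suc (suc i))
    where
    g″∣n*g′ : gcdPow (suc (suc i)) ∣ n * gcdPow (suc i)
    g″∣n*g′ = subst (gcdPow (suc (suc i)) ∣_) (sym (c*gcd[m,n]≡gcd[cm,cn] n (n ^ suc i) v))
      (gcd-greatest (gcd[m,n]∣m (n ^ suc (suc i)) v) (∣-trans (gcd[m,n]∣n (n ^ suc (suc i)) v) (n∣m*n n)))
    n*g′∣n^[1+i] : n * gcdPow (suc i) ∣ n ^ suc i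
    n*g′∣n^[1+i] = subst (λ g → n * g ∣ n ^ suc i) (sym g′≡g) (*-monoʳ-∣ n (gcd[m,n]∣m (n ^ i) v))
    g″∣g′ : gcdPow (suc (suc i)) ∣ gcdPow (suc i)
    g″∣g′ = gcd-greatest (∣-trans g″∣n*g′ n*g′∣n^[1+i]) (gcd[m,n]∣n (n ^ suc (suc i)) v)

  ratio≡1-mono : ∀ {i j} → i ≤ j → ratio (suc i) ≡ 1 → ratio (suc j) ≡ 1
  ratio≡1-mono {j = zero}  z≤n    r≡1 = r≡1
  ratio≡1-mono {i} {suc j} i≤1+j r≡1 with m≤n⇒m<n∨m≡n i≤1+j
  ... | inj₂ refl  = r≡1
  ... | inj₁ i<1+j = stable⇒ratio≡1 (suc j)
    (stable-suc j (ratio≡1⇒stable j (ratio≡1-mono (m<1+n⇒m≤n i<1+j) r≡1)))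

  unstable-growth : ∀ s → (∀ i → i < s → ratio (suc i) ≢ 1) → s < gcdPow s
  unstable-growth zero    _        = n≢0⇒n>0 (gcdPow≢0 0)
  unstable-growth (suc s) unstable = begin-strict
    suc s                    <⟨ s≤s s<g ⟩
    suc g                    ≡⟨ +-comm 1 g ⟩
    g + 1                    ≤⟨ +-monoʳ-≤ g (≤-trans (≤-trans (s≤s z≤n) s<g) (m≤m+n g 0)) ⟩
    2 * g                    ≤⟨ *-monoˡ-≤ g ratio≥2 ⟩
    ratio (suc s) * g        ≡⟨ ratio*gcdPow s ⟩
    gcdPow (suc s)           ∎
    where
    open ≤-Reasoning
    g = gcdPow s
    s<g : s < g
    s<g = unstable-growth s (λ i i<s → unstable i (m<n⇒m<1+n i<s))
    ratio≥2 : 2 ≤ ratio (suc s)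
    ratio≥2 with ratio (suc s) in eq
    ... | zero        = ⊥-elim (gcdPow≢0 (suc s) (trans (sym (ratio*gcdPow s)) (cong (_* g) eq)))
    ... | suc zero    = ⊥-elim (unstable s (n<1+n s) eq)
    ... | suc (suc _) = s≤s (s≤s z≤n)

  -- A chain of divisors of v cannot grow strictly for v steps.
  ratio[1+v]≡1 : ratio (suc v) ≡ 1
  ratio[1+v]≡1 = decidable-stable (ratio (suc v) ℕ.≟ 1) λ r≢1 →
    <-irrefl refl (<-≤-trans (unstable-growth v (λ i i<v r≡1 → r≢1 (ratio≡1-mono (<⇒≤ i<v) r≡1))) gcdPow≤v)
    where
    gcdPow≤v : gcdPow v ≤ v
    gcdPow≤v = ∣⇒≤ {{>-nonZero 0<v}} (gcd[m,n]∣n (n ^ v) v)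

  extend-gcdSeqFrom : ∀ fuel j → ratio (suc j + fuel) ≡ 1 →
                      ∀ i → extend (gcdSeqFrom n v (suc fuel) (suc j)) (suc i) ≡ ratio (suc j + i)
  extend-gcdSeqFrom fuel j r≡1 i with gcdRatio n v (suc j) ℕ.≟ 1
  extend-gcdSeqFrom fuel       j _   i       | yes r≡1 = sym (ratio≡1-mono (m≤m+n j i) r≡1)
  extend-gcdSeqFrom zero       j r≡1 i       | no  r≢1 =
    ⊥-elim (r≢1 (subst (λ k → ratio (suc k) ≡ 1) (+-identityʳ j) r≡1))
  extend-gcdSeqFrom (suc fuel) j _   zero    | no  _   =
    trans (extend-head (ratio (suc j)) rest) (cong (λ k → ratio (suc k)) (sym (+-identityʳ j)))
    where rest = gcdSeqFrom n v (suc fuel) (suc (suc j))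
  extend-gcdSeqFrom (suc fuel) j r≡1 (suc i) | no  _   = begin
    extend (ratio (suc j) ∷ rest) (suc (suc i)) ≡⟨ extend-tail _ rest i (gcdSeqFrom-nonempty fuel (suc (suc j))) ⟩
    extend rest (suc i)                         ≡⟨ extend-gcdSeqFrom fuel (suc j) r[2+j+fuel]≡1 i ⟩
    ratio (suc (suc j + i))                     ≡⟨ cong (λ k → ratio (suc k)) (sym (+-suc j i)) ⟩
    ratio (suc j + suc i)                       ∎
    where
    open ≡-Reasoning
    rest = gcdSeqFrom n v (suc fuel) (suc (suc j))
    r[2+j+fuel]≡1 : ratio (suc (suc j) + fuel) ≡ 1
    r[2+j+fuel]≡1 = trans (cong (λ k → ratio (suc k)) (sym (+-suc j fuel))) r≡1
    gcdSeqFrom-nonempty : ∀ fuel j → gcdSeqFrom n v (suc fuel) j ≢ []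
    gcdSeqFrom-nonempty fuel j eq with gcdRatio n v j ℕ.≟ 1
    gcdSeqFrom-nonempty fuel j () | yes _
    gcdSeqFrom-nonempty fuel j () | no  _

  prodUpTo-gcdN : ∀ k → prodUpTo (extend (gcdN n v)) k ≡ gcdPow k
  prodUpTo-gcdN k = trans (prodUpTo-cong (extend-gcdSeqFrom v 0 ratio[1+v]≡1) k) (prodUpTo-ratio k)

coprime-^ : ∀ {ω n} → Coprime ω n → ∀ k → Coprime ω (n ^ k)
coprime-^ ω⊥n zero    (_   , i∣1)     = ∣1⇒≡1 i∣1
coprime-^ {ω} {n} ω⊥n (suc k) {i} (i∣ω , i∣n*nᵏ) = coprime-^ ω⊥n k (i∣ω , coprime-divisor i⊥n i∣n*nᵏ)
  where
  i⊥n : Coprime i n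
  i⊥n (j∣i , j∣n) = ω⊥n (∣-trans j∣i i∣ω , j∣n)

gcd[ν*ω,m]≡gcd[m,ν] : ∀ ν {ω m} → Coprime ω m → gcd (ν * ω) m ≡ gcd m ν
gcd[ν*ω,m]≡gcd[m,ν] ν {ω} {m} ω⊥m = ∣-antisym g∣gcd[m,ν] gcd[m,ν]∣g
  where
  g = gcd (ν * ω) m
  g⊥ω : Coprime g ω
  g⊥ω (i∣g , i∣ω) = ω⊥m (i∣ω , ∣-trans i∣g (gcd[m,n]∣n (ν * ω) m))
  g∣gcd[m,ν] : g ∣ gcd m ν
  g∣gcd[m,ν] = gcd-greatest (gcd[m,n]∣n (ν * ω) m)
                            (coprime-divisor g⊥ω (subst (g ∣_) (*-comm ν ω) (gcd[m,n]∣m (ν * ω) m)))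
  gcd[m,ν]∣g : gcd m ν ∣ g
  gcd[m,ν]∣g = gcd-greatest (∣-trans (gcd[m,n]∣n m ν) (m∣m*n ω)) (gcd[m,n]∣m m ν)

proposition3p6 : (K : FiniteField) →
    (m e : ℕ) → e * m ≡ FiniteField.size K ∸ 1 →
    (n : ℕ) → 0 < n →
    (f h : Poly K) →
    Rep K f e n h →
    (∀ m' e' n' h' → e' * m' ≡ FiniteField.size K ∸ 1 → Rep K f e' n' h' → m ≤ m') →
    Nice K m e n h →
    (ν ω : ℕ) → e ≡ ν * ω →
    Coprime ω n →
    (∀ d → d ∣ e → Coprime d n → d ≤ ω) →
    (a : FiniteField.Carrier K) → a ≢ FiniteField.0# K →
    Regular (R (FunctionalGraph K f) a) (gcdN n ν)
-- The minimality of the index m and the maximality of ω are not needed.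
proposition3p6 K m e e*m≡q-1 n 0<n f h rep _ nice ν ω e≡ν*ω ω⊥n _ a a≢0 b b∈Ra k _ =
  map₂ (subst (Count (R GF a) (λ c → Walk (R GF a) k c b)) count≡v₁⋯vₖ) (R-count a≢0 b∈Ra k)
  where
  open FiniteFieldTheory.Dynamics K m e e*m≡q-1 n 0<n f h rep nice
  0<ν : 0 < ν
  0<ν = n≢0⇒n>0 λ ν≡0 → >⇒≢ 0<e (trans e≡ν*ω (cong (_* ω) ν≡0))
  count≡v₁⋯vₖ : gcd e (n ^ k) ≡ prodUpTo (extend (gcdN n ν)) k
  count≡v₁⋯vₖ = begin
    gcd e (n ^ k)                  ≡⟨ cong (λ x → gcd x (n ^ k)) e≡ν*ω ⟩
    gcd (ν * ω) (n ^ k)            ≡⟨ gcd[ν*ω,m]≡gcd[m,ν] ν (coprime-^ ω⊥n k) ⟩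
    gcd (n ^ k) ν                  ≡⟨ GcdSequence.prodUpTo-gcdN n ν 0<ν k ⟨
    prodUpTo (extend (gcdN n ν)) k ∎
    where open ≡-Reasoning
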